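{- Let $(\bar b^l)_{l<\omega}$ be an indiscernible sequence in $\mathbb{H}_n$, where $\bar b^l=(b^l_1,\dots,b^l_m)$ with $m=|\bar b^0|$. (a) For all $k<l<\omega$ and all $1\le i\le m$, $\mathbb{H}_n\models\neg\, b^k_i\, R\, b^l_i$. (b) If $m<n-1$, then the induced graph on $\bigcup_{l<\omega}\bar b^l$ is $K_{n-1}$-free.
   Context: Fix an integer $n\ge 3$; $K_m$ denotes the complete graph on $m$ vertices, and a graph is $K_m$-free if it contains no $m$ pairwise adjacent vertices. Work in the language $\{R\}$ of graphs, $R$ the (symmetric, irreflexive) edge relation. $T_n$ is the complete theory of the generic $K_n$-free graph (Henson graph), i.e. the unique countable $K_n$-free graph into which every finite $K_n$-free graph embeds as an induced subgraph and in which every isomorphism between finite induced subgraphs extends to an automorphism. $\mathbb{H}_n$ is a sufficiently saturated monster model of $T_n$. Indiscernibility is in the language $\{R\}$. -}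

module Defs where

open import Data.Nat as ℕ using (ℕ; suc; _<_; _∸_)
open import Data.Fin as Fin using (Fin; remQuot)
open import Data.Product using (Σ; ∃; ∃-syntax; _×_; _,_; proj₁; proj₂)
open import Data.Empty using (⊥)
open import Data.Unit using (⊤)
open import Relation.Nullary using (¬_)
open import Relation.Binary.PropositionalEquality using (_≡_; _≢_)
open import Function.Bundles using (_⇔_)

record Graph : Set₁ where
  field
    V      : Set
    R      : V → V → Set
    sym    : ∀ {x y} → R x y → R y x
    irrefl : ∀ {x} → ¬ R x x
open Graph public

module _ (G : Graph) where
  -- A k-clique all of whose vertices satisfy S (vertices pairwise adjacent,
  -- hence pairwise distinct by irreflexivity).
  Clique : ℕ → (V G → Set) → Set
  Clique k S = Σ (Fin k → V G) λ f →
    (∀ i → S (f i)) × (∀ i j → i ≢ j → R G (f i) (f j))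

  KFree : ℕ → (V G → Set) → Set
  KFree k S = ¬ Clique k S

  Extension : ℕ → Set
  Extension n = ∀ p q (a : Fin p → V G) (b : Fin q → V G) →
    (∀ i j → a i ≢ b j) →
    KFree (n ∸ 1) (λ v → ∃[ i ] a i ≡ v) →
    ∃[ v ] ((∀ i → R G v (a i)) × (∀ j → ¬ R G v (b j)) × (∀ j → v ≢ b j))

  -- G is a model of T_n (T_n is axiomatized by K_n-freeness plus the
  -- extension axioms).
  ModelOfT : ℕ → Set
  ModelOfT n = KFree n (λ _ → ⊤) × Extension n

  data Formula : ℕ → Set where
    rel  : ∀ {k} → Fin k → Fin k → Formula k
    eq   : ∀ {k} → Fin k → Fin k → Formula k
    neg  : ∀ {k} → Formula k → Formula k
    conj : ∀ {k} → Formula k → Formula k → Formula k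
    ex   : ∀ {k} → Formula (suc k) → Formula k

  extend : ∀ {k} → (Fin k → V G) → V G → Fin (suc k) → V G
  extend ρ v Fin.zero    = v
  extend ρ v (Fin.suc i) = ρ i

  Sat : ∀ {k} → Formula k → (Fin k → V G) → Set
  Sat (rel x y)  ρ = R G (ρ x) (ρ y)
  Sat (eq x y)   ρ = ρ x ≡ ρ y
  Sat (neg φ)    ρ = ¬ Sat φ ρ
  Sat (conj φ ψ) ρ = Sat φ ρ × Sat ψ ρ
  Sat (ex φ)     ρ = ∃[ v ] Sat φ (extend ρ v)

  StrictlyIncreasing : ∀ {r} → (Fin r → ℕ) → Set
  StrictlyIncreasing {r} s = ∀ {i j : Fin r} → i Fin.< j → s i < s j

  -- Variable x of Fin (r * m) stands for coordinate i of the l-th tuple,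
  -- where (l , i) = remQuot m x.
  assign : ∀ {m r} → (ℕ → Fin m → V G) → (Fin r → ℕ) → Fin (r ℕ.* m) → V G
  assign {m} {r} b s x = b (s (proj₁ (remQuot {r} m x))) (proj₂ (remQuot {r} m x))

  Indiscernible : ∀ {m} → (ℕ → Fin m → V G) → Set
  Indiscernible {m} b = ∀ r (φ : Formula (r ℕ.* m)) (s t : Fin r → ℕ) →
    StrictlyIncreasing s → StrictlyIncreasing t →
    Sat φ (assign b s) ⇔ Sat φ (assign b t)

{-# OPTIONS --safe #-}
-- Indiscernibility makes "b^k_i R b^l_i" independent of k < l, so one such
-- edge would make the i-th coordinates of the whole sequence an infinite
-- clique, contradicting K_n-freeness. Hence equal coordinates of distinct
-- tuples are never adjacent, and by pigeonhole any clique in the union of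
-- the tuples has at most m vertices.
module Submission where

open import Defs
open import Data.Nat using (ℕ; _≤_; _<_; _∸_; _*_; s<s)
open import Data.Nat.Properties using (<-cmp)
open import Data.Fin using (Fin; toℕ; combine; zero; suc)
open import Data.Fin.Properties using (remQuot-combine; toℕ-injective; pigeonhole; <⇒≢)
open import Data.Product using (_×_; ∃-syntax; _,_; proj₁; proj₂)
open import Data.Unit using (⊤; tt)
open import Relation.Nullary using (¬_; contradiction)
open import Relation.Binary.Definitions using (tri<; tri≈; tri>)
open import Relation.Binary.PropositionalEquality as ≡ using (_≡_; _≢_; refl; cong; cong₂; subst)
open import Function.Base using (id; _∘_)
open import Function.Bundles using (Equivalence)

module _ (G : Graph) {m : ℕ} (b : ℕ → Fin m → V G) where

  pair : ℕ → ℕ → Fin 2 → ℕ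
  pair k l zero    = k
  pair k l (suc _) = l

  pair-increasing : ∀ {k l} → k < l → StrictlyIncreasing G (pair k l)
  pair-increasing k<l {zero}  {suc zero} _         = k<l
  pair-increasing k<l {suc zero} {suc zero} (s<s ())

  assign-pair : ∀ k l j i → assign G b (pair k l) (combine {2} j i) ≡ b (pair k l j) i
  assign-pair k l j i =
    cong (λ (j , i) → b (pair k l j) i) (remQuot-combine {2} j i)

  module _ (ind : Indiscernible G b) (i : Fin m) where

    coordinate-edge : Formula G (2 * m)
    coordinate-edge = rel (combine {2} zero i) (combine {2} (suc zero) i)

    sat-coordinate-edge : ∀ k l →
                          Sat G coordinate-edge (assign G b (pair k l)) ≡ R G (b k i) (b l i)
    sat-coordinate-edge k l = cong₂ (R G) (assign-pair k l zero i) (assign-pair k l (suc zero) i)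

    edge-transfer : ∀ {k l k′ l′} → k < l → k′ < l′ →
                    R G (b k i) (b l i) → R G (b k′ i) (b l′ i)
    edge-transfer {k} {l} {k′} {l′} k<l k′<l′ =
      subst id (sat-coordinate-edge k′ l′)
      ∘ Equivalence.to (ind 2 coordinate-edge (pair k l) (pair k′ l′)
                          (pair-increasing k<l) (pair-increasing k′<l′))
      ∘ subst id (≡.sym (sat-coordinate-edge k l))

    coordinate-clique : ∀ {k l} → k < l → R G (b k i) (b l i) →
                        ∀ r → Clique G r (λ _ → ⊤)
    coordinate-clique k<l e r = (λ j → b (toℕ j) i) , (λ _ → tt) , adjacent
      where
      adjacent : ∀ j j′ → j ≢ j′ → R G (b (toℕ j) i) (b (toℕ j′) i)
      adjacent j j′ j≢j′ with <-cmp (toℕ j) (toℕ j′)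
      ... | tri< j<j′ _ _ = edge-transfer k<l j<j′ e
      ... | tri≈ _ j≡j′ _ = contradiction (toℕ-injective j≡j′) j≢j′
      ... | tri> _ _ j′<j = sym G (edge-transfer k<l j′<j e)

    coordinate-nonadjacent : ∀ {n} → KFree G n (λ _ → ⊤) →
                             ∀ {k l} → k < l → ¬ R G (b k i) (b l i)
    coordinate-nonadjacent kfree k<l e = kfree (coordinate-clique k<l e _)

    coordinate-independent : ∀ {n} → KFree G n (λ _ → ⊤) →
                             ∀ l l′ → ¬ R G (b l i) (b l′ i)
    coordinate-independent kfree l l′ e with <-cmp l l′
    ... | tri< l<l′ _ _ = coordinate-nonadjacent kfree l<l′ e
    ... | tri≈ _ refl _ = irrefl G e
    ... | tri> _ _ l′<l = coordinate-nonadjacent kfree l′<l (sym G e)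

  Union : V G → Set
  Union v = ∃[ l ] ∃[ i ] b l i ≡ v

  union-KFree : (∀ l l′ i → ¬ R G (b l i) (b l′ i)) → ∀ {r} → m < r → KFree G r Union
  union-KFree independent m<r (f , member , adjacent)
    with pigeonhole m<r (λ j → proj₁ (proj₂ (member j)))
  ... | j , j′ , j<j′ , same = same-coordinate (member j) (member j′) same (adjacent j j′ (<⇒≢ j<j′))
    where
    same-coordinate : ∀ {u v} (p : Union u) (q : Union v) →
                      proj₁ (proj₂ p) ≡ proj₁ (proj₂ q) → ¬ R G u v
    same-coordinate (l , i , refl) (l′ , .i , refl) refl = independent l l′ i

lemma4p1 : (n : ℕ) → 3 ≤ n → (G : Graph) → ModelOfT G n →
    (m : ℕ) (b : ℕ → Fin m → V G) → Indiscernible G b →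
    ((k l : ℕ) → k < l → (i : Fin m) → ¬ R G (b k i) (b l i))
    × (m < n ∸ 1 → KFree G (n ∸ 1) (λ v → ∃[ l ] ∃[ i ] b l i ≡ v))
lemma4p1 n _ G (kfree , _) m b ind =
    (λ k l k<l i → coordinate-nonadjacent G b ind i kfree k<l)
  , union-KFree G b (λ l l′ i → coordinate-independent G b ind i kfree l l′)
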